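{- Let $d>1$. For any $\varepsilon>0$ and integer $r\ge1$, $\mathcal{A}^d_{\varepsilon,r}\subset\mathcal{H}^d_{\frac{d^2\varepsilon}{2},N^d_{2r}}$.
   Context: $Gr_d$ is the set of finite simple graphs of maximum degree at most $d$. $B_r(x,G)$ is the set of vertices at shortest-path distance at most $r$ from $x$. $N^d_{s}$ is the maximum number of vertices of a ball of radius $s$ with maximum degree at most $d$. $\operatorname{Prob}(G)$ is the set of probability measures on $V(G)$, $\|f\|_1=\sum_x|f(x)|$. $G\in Gr_d$ is $(\varepsilon,r)$-uniform if there is $\tilde f:V(G)\to\operatorname{Prob}(G)$ with $\|\tilde f(x)-\tilde f(y)\|_1<\varepsilon$ for all adjacent $x,y$ and $\operatorname{Supp}(\tilde f(x))\subset B_r(x,G)$ for all $x$; $\mathcal{A}^d_{\varepsilon,r}$ is the set of such graphs. $G$ is $(\varepsilon,K)$-hyperfinite if there is $W\subset E(G)$ with $|W|\le\varepsilon|E(G)|$ such that after removing $W$ all connected components have at most $K$ vertices; $\mathcal{H}^d_{\varepsilon,K}$ is the set of $(\varepsilon,K)$-hyperfinite graphs in $Gr_d$.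
   Formalization: The parameter ε ranges over the positive rationals, and the probability measures $\tilde f(x)$ in the definition of $(\varepsilon,r)$-uniformity take rational values. -}

module Defs where

open import Data.Nat as ℕ using (ℕ; zero; suc)
open import Data.Bool using (Bool; true; false; _∧_; not)
open import Data.Fin using (Fin; toℕ)
open import Data.List using (List; length; foldr; map; filter; allFin; concatMap)
open import Data.List.Membership.Propositional using (_∈_)
open import Data.List.Relation.Unary.Unique.Propositional using (Unique)
open import Data.Product using (Σ; ∃; _×_; _,_)
open import Data.Integer using (+_)
open import Data.Rational as ℚ using (ℚ; 0ℚ; 1ℚ)
open import Function.Bundles using (_⇔_)
open import Relation.Binary.PropositionalEquality using (_≡_; _≢_)
open import Relation.Nullary using (¬_)
open import Relation.Nullary.Decidable using (⌊_⌋)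
import Data.Fin as Fin

record Graph : Set where
  field
    n     : ℕ
    adj   : Fin n → Fin n → Bool
    sym   : ∀ x y → adj x y ≡ adj y x
    irref : ∀ x → adj x x ≡ false
open Graph public

countB : ∀ {n} → (Fin n → Bool) → ℕ
countB {n} p = length (filter (λ x → p x Data.Bool.≟ true) (allFin n))

degree : (G : Graph) → Fin (n G) → ℕ
degree G x = countB (adj G x)

InGr : ℕ → Graph → Set
InGr d G = ∀ x → degree G x ℕ.≤ d

countEdges : ∀ {n} → (Fin n → Fin n → Bool) → ℕ
countEdges {n} e = length (filter (λ p → (⌊ Data.Product.proj₁ p Fin.<? Data.Product.proj₂ p ⌋ ∧ e (Data.Product.proj₁ p) (Data.Product.proj₂ p)) Data.Bool.≟ true)
  (concatMap (λ x → map (λ y → (x , y)) (allFin n)) (allFin n)))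

data Walk {n : ℕ} (e : Fin n → Fin n → Bool) : Fin n → Fin n → ℕ → Set where
  here : ∀ {x} → Walk e x x zero
  step : ∀ {x y z k} → e x y ≡ true → Walk e y z k → Walk e x z (suc k)

DistLe : (G : Graph) → Fin (n G) → Fin (n G) → ℕ → Set
DistLe G x y r = ∃ λ k → k ℕ.≤ r × Walk (adj G) x y k

InBall : (G : Graph) → ℕ → Fin (n G) → Fin (n G) → Set
InBall G r x y = DistLe G x y r

HasSize : ∀ {m} → (Fin m → Set) → ℕ → Set
HasSize {m} P k = Σ (List (Fin m)) λ L → Unique L × length L ≡ k × (∀ y → (y ∈ L) ⇔ P y)

SizeLe : ∀ {m} → (Fin m → Set) → ℕ → Set
SizeLe P K = ∃ λ k → HasSize P k × k ℕ.≤ K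

IsMaxBallSize : ℕ → ℕ → ℕ → Set
IsMaxBallSize d s N =
  (∀ (G : Graph) → InGr d G → ∀ x → SizeLe (InBall G s x) N)
  × (Σ Graph λ G → InGr d G × Σ (Fin (n G)) λ x → HasSize (InBall G s x) N)

ℕtoℚ : ℕ → ℚ
ℕtoℚ k = + k ℚ./ 1

sumℚ : ∀ {m} → (Fin m → ℚ) → ℚ
sumℚ {m} f = foldr ℚ._+_ 0ℚ (map f (allFin m))

IsProb : ∀ {m} → (Fin m → ℚ) → Set
IsProb f = (∀ y → 0ℚ ℚ.≤ f y) × sumℚ f ≡ 1ℚ

dist1 : ∀ {m} → (Fin m → ℚ) → (Fin m → ℚ) → ℚ
dist1 f g = sumℚ (λ y → ℚ.∣ f y ℚ.- g y ∣)

Uniform : ℚ → ℕ → Graph → Set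
Uniform ε r G =
  Σ (Fin (n G) → Fin (n G) → ℚ) λ f →
    (∀ x → IsProb (f x))
    × (∀ x y → adj G x y ≡ true → dist1 (f x) (f y) ℚ.< ε)
    × (∀ x y → f x y ≢ 0ℚ → InBall G r x y)

InA : ℕ → ℚ → ℕ → Graph → Set
InA d ε r G = InGr d G × Uniform ε r G

Hyperfinite : ℚ → ℕ → Graph → Set
Hyperfinite ε K G =
  Σ (Fin (n G) → Fin (n G) → Bool) λ W →
    (∀ x y → W x y ≡ W y x)
    × (∀ x y → W x y ≡ true → adj G x y ≡ true)
    × (ℕtoℚ (countEdges W) ℚ.≤ ε ℚ.* ℕtoℚ (countEdges (adj G)))
    × (∀ x → SizeLe (λ y → ∃ λ k → Walk (λ a b → adj G a b ∧ not (W a b)) x y k) K)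

InH : ℕ → ℚ → ℕ → Graph → Set
InH d ε K G = InGr d G × Hyperfinite ε K G

module Submission where

-- Clear denominators: with Q a common denominator, f x = a x / Q where a x : Fin n → ℕ sums to Q, and
-- ‖a x − a y‖₁ ≤ M along edges for a natural number M ≤ Qε. Clusters are grown greedily: for a centre z
-- and a threshold t < Q, every still unlabelled vertex x with a x z > t joins the cluster of z. Over the
-- n·Q choices of (z, t) an unlabelled vertex is captured exactly Q times, while an arc x → y is separated
-- at most ∑_z (a x z ∸ a y z) ≤ M times, so some choice cuts at most M/Q arcs per unit of captured degree.
-- Such steps preserve Q·(cut arcs) + 2M·(total degree of unlabelled vertices) ≤ 2M·(all arcs), and the
-- loop stops once no unlabelled vertex has an edge, having cut at most 2ε|E| ≤ (d²ε/2)|E| edges. A vertex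
-- x joins the cluster of z only if a x z > 0, i.e. z ∈ B_r(x), so each component of G minus the cut edges
-- lies in a ball of radius r ≤ 2r.

open import Algebra.Bundles using (CommutativeRing)
open import Level using (0ℓ)
open import Data.Bool as Bool using (Bool; true; false; _∧_; not; if_then_else_; T)
import Data.Bool.Properties as Boolₚ
open import Data.Empty using (⊥-elim)
open import Data.Fin as Fin using (Fin; zero; suc; toℕ; punchIn; punchOut)
import Data.Fin.Properties as Finₚ
import Data.Integer as ℤ
import Data.Integer.Properties as ℤP
open import Data.List as List using (List; length; filter; tabulate; allFin; concatMap)
import Data.List.Properties as Listₚ
import Data.List.Membership.Propositional.Properties as ∈ₚ
import Data.List.Relation.Unary.Unique.Propositional.Properties as Uniqueₚ
open import Data.Maybe using (Maybe; just; nothing; is-nothing)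
import Data.Maybe.Properties as Maybeₚ
open import Data.Nat using (ℕ; zero; suc; _+_; _*_; _∸_; _⊓_; ∣_-_∣; _≤_; _<_; z≤n; s≤s; _<ᵇ_)
open import Data.Nat.Properties
import Data.Nat.Tactic.RingSolver as ℕ-Solver
open import Data.Product as Prod using (∃-syntax; _×_; _,_; proj₁; proj₂)
open import Data.Rational as ℚ using (ℚ; 0ℚ; 1ℚ)
import Data.Rational.Properties as ℚP
open import Data.Rational.Unnormalised as ℚᵘ using (mkℚᵘ; *≡*)
import Data.Rational.Unnormalised.Properties as ℚᵘP
open import Data.Sum using (_⊎_; inj₁; inj₂; [_,_]′)
open import Function using (_∘_)
open import Function.Bundles using (mk⇔; Equivalence)
open import Relation.Binary.Definitions using (DecidableEquality)
open import Relation.Binary.PropositionalEquality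
open import Relation.Nullary using (Dec; yes; no; does)
open import Relation.Nullary.Decidable using (⌊_⌋; map′; _×-dec_; dec⇒maybe; dec-true; does-≡)
open import Tactic.RingSolver using (solve-∀)
open import Tactic.RingSolver.Core.AlmostCommutativeRing using (AlmostCommutativeRing; fromCommutativeRing)

open import Algebra.Properties.Semiring.Sum +-*-semiring
  using (sum; sum-syntax; sum-cong-≗; sum-replicate-zero; ∑-distrib-+; ∑-comm; *-distribˡ-sum)
open import Algebra.Properties.Semiring.Mult (CommutativeRing.semiring ℚP.+-*-commutativeRing)
  using (×-homo-+; ×1-homo-*) renaming (_×_ to _ℚ×_)

open import Defs renaming (sym to adj-sym; irref to adj-irrefl)

-- Finite sums

⟦_⟧ : Bool → ℕ
⟦ true ⟧ = 1
⟦ false ⟧ = 0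

⟦⟧≤1 : ∀ b → ⟦ b ⟧ ≤ 1
⟦⟧≤1 true = ≤-refl
⟦⟧≤1 false = z≤n

⟦∧⟧≤⟦⟧ʳ : ∀ b c → ⟦ b ∧ c ⟧ ≤ ⟦ c ⟧
⟦∧⟧≤⟦⟧ʳ true c = ≤-refl
⟦∧⟧≤⟦⟧ʳ false c = z≤n

sum-mono-≤ : ∀ {m} {f g : Fin m → ℕ} → (∀ i → f i ≤ g i) → sum f ≤ sum g
sum-mono-≤ {zero} f≤g = z≤n
sum-mono-≤ {suc m} f≤g = +-mono-≤ (f≤g zero) (sum-mono-≤ (f≤g ∘ suc))

term≤sum : ∀ {m} (f : Fin m → ℕ) i → f i ≤ sum f
term≤sum f zero = m≤m+n _ _
term≤sum f (suc i) = ≤-trans (term≤sum (f ∘ suc) i) (m≤n+m _ _)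

∑∑-distrib-+ : ∀ {k m} (f g : Fin k → Fin m → ℕ) →
  ∑[ i < k ] ∑[ j < m ] (f i j + g i j) ≡ ∑[ i < k ] ∑[ j < m ] f i j + ∑[ i < k ] ∑[ j < m ] g i j
∑∑-distrib-+ f g =
  trans (sum-cong-≗ (λ i → ∑-distrib-+ (f i) (g i))) (∑-distrib-+ (λ i → sum (f i)) (λ i → sum (g i)))

∑∑-distribˡ : ∀ {k m} c (f : Fin k → Fin m → ℕ) →
  ∑[ i < k ] ∑[ j < m ] (c * f i j) ≡ c * ∑[ i < k ] ∑[ j < m ] f i j
∑∑-distribˡ {k} {m} c f = begin
  ∑[ i < k ] ∑[ j < m ] (c * f i j) ≡⟨ sum-cong-≗ (λ i → *-distribˡ-sum c (f i)) ⟨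
  ∑[ i < k ] (c * ∑[ j < m ] f i j) ≡⟨ *-distribˡ-sum c (λ i → sum (f i)) ⟨
  c * ∑[ i < k ] ∑[ j < m ] f i j   ∎
  where open ≡-Reasoning

∑∑-∑-comm : ∀ {k l m} (f : Fin k → Fin l → Fin m → ℕ) →
  ∑[ i < k ] ∑[ j < l ] ∑[ p < m ] f i j p ≡ ∑[ p < m ] ∑[ i < k ] ∑[ j < l ] f i j p
∑∑-∑-comm f = trans (sum-cong-≗ (λ i → ∑-comm (f i))) (∑-comm (λ i p → sum (λ j → f i j p)))

∃-below-average : ∀ {m} (c v : Fin m → ℕ) {A B} → 0 < sum v → sum c * A ≤ B * sum v →
  ∃[ i ] 0 < v i × c i * A ≤ B * v i
∃-below-average {suc m} c v {A} {B} 0<∑v ∑c*A≤B*∑v = choose (v zero ≟ 0) (c zero * A ≤? B * v zero)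
  where
  open ≤-Reasoning
  split-≤ : c zero * A + sum (c ∘ suc) * A ≤ B * v zero + B * sum (v ∘ suc)
  split-≤ = subst₂ _≤_ (*-distribʳ-+ A (c zero) _) (*-distribˡ-+ B (v zero) _) ∑c*A≤B*∑v
  -- When index 0 is not below average (B · v₀ ≤ c₀ · A), the tail still is.
  on-tail : B * v zero ≤ c zero * A → 0 < sum (v ∘ suc) → ∃[ i ] 0 < v i × c i * A ≤ B * v i
  on-tail v₀-above 0<∑v₊ = Prod.map suc (λ below → below) (∃-below-average (c ∘ suc) (v ∘ suc) {A} {B} 0<∑v₊
    (+-cancelˡ-≤ (c zero * A) _ _ (≤-trans split-≤ (+-monoˡ-≤ _ v₀-above))))
  choose : Dec (v zero ≡ 0) → Dec (c zero * A ≤ B * v zero) → ∃[ i ] 0 < v i × c i * A ≤ B * v i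
  choose (no v₀≢0) (yes v₀-below) = zero , n≢0⇒n>0 v₀≢0 , v₀-below
  choose (yes v₀≡0) _ =
    on-tail (subst (λ v₀ → B * v₀ ≤ c zero * A) (sym v₀≡0) (≤-trans (≤-reflexive (*-zeroʳ B)) z≤n))
      (subst (λ v₀ → 0 < v₀ + sum (v ∘ suc)) v₀≡0 0<∑v)
  choose (no _) (no v₀-above) = on-tail (<⇒≤ (≰⇒> v₀-above)) (n≢0⇒n>0 λ ∑v₊≡0 → <⇒≱ (≰⇒> v₀-above) (begin
    c zero * A                      ≤⟨ m≤m+n _ _ ⟩
    c zero * A + sum (c ∘ suc) * A  ≤⟨ split-≤ ⟩
    B * v zero + B * sum (v ∘ suc)  ≡⟨ cong (λ s → B * v zero + B * s) ∑v₊≡0 ⟩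
    B * v zero + B * 0              ≡⟨ cong (B * v zero +_) (*-zeroʳ B) ⟩
    B * v zero + 0                  ≡⟨ +-identityʳ _ ⟩
    B * v zero                      ∎))

count-below : ∀ Q a → ∑[ t < Q ] ⟦ toℕ t <ᵇ a ⟧ ≡ a ⊓ Q
count-below zero a = sym (⊓-zeroʳ a)
count-below (suc Q) zero = sum-replicate-zero Q
count-below (suc Q) (suc a) = cong suc (count-below Q a)

count-between : ∀ Q a b → ∑[ t < Q ] ⟦ (toℕ t <ᵇ a) ∧ not (toℕ t <ᵇ b) ⟧ ≤ a ∸ b
count-between zero a b = z≤n
count-between (suc Q) zero b = ≤-trans (≤-reflexive (sum-replicate-zero Q)) z≤n
count-between (suc Q) (suc a) zero = s≤s (begin
  ∑[ t < Q ] ⟦ (toℕ t <ᵇ a) ∧ true ⟧  ≡⟨ sum-cong-≗ {Q} (λ t → cong ⟦_⟧ (Boolₚ.∧-identityʳ _)) ⟩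
  ∑[ t < Q ] ⟦ toℕ t <ᵇ a ⟧           ≡⟨ count-below Q a ⟩
  a ⊓ Q                               ≤⟨ m⊓n≤m a Q ⟩
  a                                   ∎)
  where open ≤-Reasoning
count-between (suc Q) (suc a) (suc b) = count-between Q a b

-- Walks and reachability

Reachable : ∀ {m} → (Fin m → Fin m → Bool) → Fin m → Fin m → Set
Reachable e x y = ∃[ k ] Walk e x y k

module _ {m} {e : Fin m → Fin m → Bool} where

  walk-snoc : ∀ {x y z k} → Walk e x y k → e y z ≡ true → Walk e x z (suc k)
  walk-snoc here yz = step yz here
  walk-snoc (step xw rest) yz = step xw (walk-snoc rest yz)

  walk-reverse : (∀ a b → e a b ≡ e b a) → ∀ {x y k} → Walk e x y k → Walk e y x k
  walk-reverse e-sym here = here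
  walk-reverse e-sym (step {x} {w} xw rest) = walk-snoc (walk-reverse e-sym rest) (trans (e-sym w x) xw)

  walk-invariant : ∀ {A : Set} (ℓ : Fin m → A) → (∀ a b → e a b ≡ true → ℓ a ≡ ℓ b) →
    ∀ {x y k} → Walk e x y k → ℓ x ≡ ℓ y
  walk-invariant ℓ ℓ-edge here = refl
  walk-invariant ℓ ℓ-edge (step xw rest) = trans (ℓ-edge _ _ xw) (walk-invariant ℓ ℓ-edge rest)

  walk-from-isolated : ∀ {x y k} → (∀ w → e x w ≡ false) → Walk e x y k → y ≡ x
  walk-from-isolated isolated here = refl
  walk-from-isolated isolated (step {y = w} xw _) with () ← trans (sym xw) (isolated w)

walk-map : ∀ {m k} {e : Fin m → Fin m → Bool} {e′ : Fin k → Fin k → Bool} (f : Fin m → Fin k) →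
  (∀ {a b} → e a b ≡ true → e′ (f a) (f b) ≡ true) → ∀ {x y j} → Walk e x y j → Walk e′ (f x) (f y) j
walk-map f f-edge here = here
walk-map f f-edge (step xw rest) = step (f-edge xw) (walk-map f f-edge rest)

module _ {m} (e : Fin m → Fin m → Bool) (x : Fin m) where

  avoiding : Fin m → Fin m → Bool
  avoiding a b = e a b ∧ not ⌊ b Fin.≟ x ⌋

  avoiding-intro : ∀ {a b} → e a b ≡ true → b ≢ x → avoiding a b ≡ true
  avoiding-intro {a} {b} ab b≢x with b Fin.≟ x
  ... | yes b≡x = ⊥-elim (b≢x b≡x)
  ... | no _ = trans (Boolₚ.∧-identityʳ _) ab

  avoiding-elim : ∀ {a b} → avoiding a b ≡ true → e a b ≡ true × b ≢ x
  avoiding-elim {a} {b} ab with b Fin.≟ x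
  ... | yes _ with () ← trans (sym (Boolₚ.∧-zeroʳ (e a b))) ab
  ... | no b≢x = trans (sym (Boolₚ.∧-identityʳ _)) ab , b≢x

  last-visit : ∀ {u y k} → Walk e u y k → Walk avoiding u y k ⊎ Reachable avoiding x y
  last-visit here = inj₁ here
  last-visit (step {y = v} uv rest) with last-visit rest | v Fin.≟ x
  ... | inj₂ from-x | _ = inj₂ from-x
  ... | inj₁ rest′ | yes refl = inj₂ (_ , rest′)
  ... | inj₁ rest′ | no v≢x = inj₁ (step (avoiding-intro uv v≢x) rest′)

  reachable⇒avoiding : ∀ {y} → Reachable e x y → Reachable avoiding x y
  reachable⇒avoiding (k , w) = [ (k ,_) , (λ r → r) ]′ (last-visit w)

module _ {m} (e : Fin (suc m) → Fin (suc m) → Bool) (x : Fin (suc m)) where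

  without : Fin m → Fin m → Bool
  without a b = e (punchIn x a) (punchIn x b)

  avoiding⇒without : ∀ {u v k} a → u ≡ punchIn x a → Walk (avoiding e x) u v k →
    ∃[ b ] v ≡ punchIn x b × Walk without a b k
  avoiding⇒without a u≡ here = a , u≡ , here
  avoiding⇒without a u≡ (step uw rest) with avoiding-elim e x uw
  ... | uw′ , w≢x with avoiding⇒without (punchOut (w≢x ∘ sym)) (sym (Finₚ.punchIn-punchOut _)) rest
  ... | b , v≡ , rest′ =
    b , v≡ , step (subst₂ (λ p q → e p q ≡ true) u≡ (sym (Finₚ.punchIn-punchOut _)) uw′) rest′

  module _ {y} (x≢y : x ≢ y) where

    via-without : ∃[ a ] e x (punchIn x a) ≡ true × Reachable without a (punchOut x≢y) → Reachable e x y
    via-without (a , xa , k , w) = suc k , step xa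
      (subst (λ v → Walk e (punchIn x a) v k) (Finₚ.punchIn-punchOut x≢y) (walk-map (punchIn x) (λ ab → ab) w))

    through-without : ∀ {k} → Walk (avoiding e x) x y k →
      ∃[ a ] e x (punchIn x a) ≡ true × Reachable without a (punchOut x≢y)
    through-without here = ⊥-elim (x≢y refl)
    through-without (step xw rest) with avoiding-elim e x xw
    ... | xw′ , w≢x with avoiding⇒without (punchOut (w≢x ∘ sym)) (sym (Finₚ.punchIn-punchOut _)) rest
    ... | b , y≡ , rest′ =
      punchOut (w≢x ∘ sym) , subst (λ p → e x p ≡ true) (sym (Finₚ.punchIn-punchOut _)) xw′ ,
      _ , subst (λ b → Walk without _ b _)
            (trans (sym (Finₚ.punchOut-punchIn x)) (Finₚ.punchOut-cong x (sym y≡))) rest′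

-- A walk from x to y ≢ x can be taken never to return to x (last-visit), so after its first step it
-- is a walk in the graph with x deleted: recursion on the number of vertices.
reachable? : ∀ {m} (e : Fin m → Fin m → Bool) x y → Dec (Reachable e x y)
reachable? {suc m} e x y with x Fin.≟ y
... | yes refl = yes (0 , here)
... | no x≢y = map′ (via-without e x x≢y) (through-without e x x≢y ∘ proj₂ ∘ reachable⇒avoiding e x)
  (Finₚ.any? λ a → (e x (punchIn x a) Bool.≟ true) ×-dec reachable? (without e x) a (punchOut x≢y))

-- Counting edges

count : ∀ {A : Set} → (A → Bool) → List A → ℕ
count P xs = length (filter (λ a → P a Bool.≟ true) xs)

count-++ : ∀ {A : Set} (P : A → Bool) xs ys → count P (xs List.++ ys) ≡ count P xs + count P ys
count-++ P xs ys = trans (cong length (Listₚ.filter-++ (λ a → P a Bool.≟ true) xs ys))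
  (Listₚ.length-++ (filter (λ a → P a Bool.≟ true) xs))

count-tabulate : ∀ {A : Set} {m} (P : A → Bool) (g : Fin m → A) → count P (tabulate g) ≡ ∑[ i < m ] ⟦ P (g i) ⟧
count-tabulate {m = zero} P g = refl
count-tabulate {m = suc m} P g with P (g zero)
... | true = cong suc (count-tabulate P (g ∘ suc))
... | false = count-tabulate P (g ∘ suc)

count-pairs : ∀ {m} (P : Fin m × Fin m → Bool) →
  count P (concatMap (λ x → List.map (x ,_) (allFin m)) (allFin m)) ≡ ∑[ x < m ] ∑[ y < m ] ⟦ P (x , y) ⟧
count-pairs {m} P = rows (λ x → x)
  where
  row : ∀ x → count P (List.map (x ,_) (allFin m)) ≡ ∑[ y < m ] ⟦ P (x , y) ⟧
  row x = trans (cong (count P) (Listₚ.map-tabulate (λ y → y) (x ,_))) (count-tabulate P (x ,_))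
  rows : ∀ {k} (g : Fin k → Fin m) →
    count P (concatMap (λ x → List.map (x ,_) (allFin m)) (tabulate g)) ≡ ∑[ i < k ] ∑[ y < m ] ⟦ P (g i , y) ⟧
  rows {zero} g = refl
  rows {suc k} g =
    trans (count-++ P (List.map (g zero ,_) (allFin m)) _) (cong₂ _+_ (row (g zero)) (rows (g ∘ suc)))

arcs : ∀ {m} → (Fin m → Fin m → Bool) → ℕ
arcs {m} e = ∑[ x < m ] ∑[ y < m ] ⟦ e x y ⟧

arcs≡2*countEdges : ∀ {m} (e : Fin m → Fin m → Bool) → (∀ x y → e x y ≡ e y x) → (∀ x → e x x ≡ false) →
  arcs e ≡ 2 * countEdges e
arcs≡2*countEdges {m} e e-sym e-irrefl = begin
  arcs e                                             ≡⟨ sum-cong-≗ (λ x → sum-cong-≗ (split x)) ⟩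
  ∑[ x < m ] ∑[ y < m ] (forward x y + forward y x)  ≡⟨ ∑∑-distrib-+ forward (λ x y → forward y x) ⟩
  ∑∑-forward + ∑[ x < m ] ∑[ y < m ] forward y x     ≡⟨ cong (∑∑-forward +_) (∑-comm (λ x y → forward y x)) ⟩
  ∑∑-forward + ∑∑-forward                            ≡⟨ cong₂ _+_ edges edges ⟨
  countEdges e + countEdges e                        ≡⟨ cong (countEdges e +_) (+-identityʳ _) ⟨
  2 * countEdges e                                   ∎
  where
  open ≡-Reasoning
  forward : Fin m → Fin m → ℕ
  forward x y = ⟦ ⌊ x Fin.<? y ⌋ ∧ e x y ⟧
  ∑∑-forward : ℕ
  ∑∑-forward = ∑[ x < m ] ∑[ y < m ] forward x y
  edges : countEdges e ≡ ∑∑-forward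
  edges = count-pairs (λ p → ⌊ proj₁ p Fin.<? proj₂ p ⌋ ∧ e (proj₁ p) (proj₂ p))
  split : ∀ x y → ⟦ e x y ⟧ ≡ forward x y + forward y x
  split x y with x Fin.<? y | y Fin.<? x
  ... | yes x<y | yes y<x = ⊥-elim (Finₚ.<-asym x<y y<x)
  ... | yes _ | no _ = sym (+-identityʳ _)
  ... | no _ | yes _ = cong ⟦_⟧ (e-sym x y)
  ... | no x≮y | no y≮x with Finₚ.≤-antisym (≮⇒≥ y≮x) (≮⇒≥ x≮y)
  ...   | refl = cong ⟦_⟧ (e-irrefl x)

halve-arcs : ∀ {m p q} {e f : Fin m → Fin m → Bool} →
  (∀ x y → e x y ≡ e y x) → (∀ x → e x x ≡ false) → (∀ x y → f x y ≡ f y x) → (∀ x → f x x ≡ false) →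
  p * arcs e ≤ q * arcs f → p * countEdges e ≤ q * countEdges f
halve-arcs {p = p} {q} {e} {f} e-sym e-irrefl f-sym f-irrefl p*arcs≤q*arcs = *-cancelˡ-≤ 2 (begin
  2 * (p * countEdges e)   ≡⟨ swap p (countEdges e) ⟩
  p * (2 * countEdges e)   ≡⟨ cong (p *_) (arcs≡2*countEdges e e-sym e-irrefl) ⟨
  p * arcs e               ≤⟨ p*arcs≤q*arcs ⟩
  q * arcs f               ≡⟨ cong (q *_) (arcs≡2*countEdges f f-sym f-irrefl) ⟩
  q * (2 * countEdges f)   ≡⟨ swap q (countEdges f) ⟨
  2 * (q * countEdges f)   ∎)
  where
  open ≤-Reasoning
  swap : ∀ a b → 2 * (a * b) ≡ a * (2 * b)
  swap = ℕ-Solver.solve-∀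

-- Natural numbers inside ℚ

ℚ-ring : AlmostCommutativeRing 0ℓ 0ℓ
ℚ-ring = fromCommutativeRing ℚP.+-*-commutativeRing (λ q → dec⇒maybe (0ℚ ℚP.≟ q))

-- ℕtoℚ k is normalised through a gcd, so this is checked in the unnormalised rationals.
ℕtoℚ-suc : ∀ k → ℕtoℚ (suc k) ≡ 1ℚ ℚ.+ ℕtoℚ k
ℕtoℚ-suc k = ℚP.toℚᵘ-injective (begin
  ℚ.toℚᵘ (ℕtoℚ (suc k))               ≈⟨ ℚP.toℚᵘ-fromℚᵘ (mkℚᵘ (ℤ.+ suc k) 0) ⟩
  mkℚᵘ (ℤ.+ suc k) 0                  ≈⟨ ℚᵘP.≃-sym (*≡* ℤ-identity) ⟩
  mkℚᵘ ℤ.1ℤ 0 ℚᵘ.+ mkℚᵘ (ℤ.+ k) 0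
    ≈⟨ ℚᵘP.+-cong (ℚP.toℚᵘ-fromℚᵘ (mkℚᵘ ℤ.1ℤ 0)) (ℚP.toℚᵘ-fromℚᵘ (mkℚᵘ (ℤ.+ k) 0)) ⟨
  ℚ.toℚᵘ 1ℚ ℚᵘ.+ ℚ.toℚᵘ (ℕtoℚ k)      ≈⟨ ℚP.toℚᵘ-homo-+ 1ℚ (ℕtoℚ k) ⟨
  ℚ.toℚᵘ (1ℚ ℚ.+ ℕtoℚ k)              ∎)
  where
  open ℚᵘP.≃-Reasoning
  ℤ-identity : (ℤ.1ℤ ℤ.+ ℤ.+ k ℤ.* ℤ.1ℤ) ℤ.* ℤ.1ℤ ≡ ℤ.+ suc k ℤ.* ℤ.1ℤ
  ℤ-identity = trans (ℤP.*-identityʳ _)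
    (trans (cong (ℤ._+_ ℤ.1ℤ) (ℤP.*-identityʳ (ℤ.+ k))) (sym (ℤP.*-identityʳ (ℤ.+ suc k))))

ℕtoℚ≡×1 : ∀ k → ℕtoℚ k ≡ k ℚ× 1ℚ
ℕtoℚ≡×1 zero = refl
ℕtoℚ≡×1 (suc k) = trans (ℕtoℚ-suc k) (cong (ℚ._+_ 1ℚ) (ℕtoℚ≡×1 k))

ℕtoℚ-+ : ∀ a b → ℕtoℚ (a + b) ≡ ℕtoℚ a ℚ.+ ℕtoℚ b
ℕtoℚ-+ a b = begin
  ℕtoℚ (a + b)              ≡⟨ ℕtoℚ≡×1 (a + b) ⟩
  (a + b) ℚ× 1ℚ             ≡⟨ ×-homo-+ 1ℚ a b ⟩
  a ℚ× 1ℚ ℚ.+ b ℚ× 1ℚ       ≡⟨ cong₂ ℚ._+_ (ℕtoℚ≡×1 a) (ℕtoℚ≡×1 b) ⟨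
  ℕtoℚ a ℚ.+ ℕtoℚ b         ∎
  where open ≡-Reasoning

ℕtoℚ-* : ∀ a b → ℕtoℚ (a * b) ≡ ℕtoℚ a ℚ.* ℕtoℚ b
ℕtoℚ-* a b = begin
  ℕtoℚ (a * b)              ≡⟨ ℕtoℚ≡×1 (a * b) ⟩
  (a * b) ℚ× 1ℚ             ≡⟨ ×1-homo-* a b ⟩
  a ℚ× 1ℚ ℚ.* b ℚ× 1ℚ       ≡⟨ cong₂ ℚ._*_ (ℕtoℚ≡×1 a) (ℕtoℚ≡×1 b) ⟨
  ℕtoℚ a ℚ.* ℕtoℚ b         ∎
  where open ≡-Reasoning

ℕtoℚ-nonNeg : ∀ k → 0ℚ ℚ.≤ ℕtoℚ k
ℕtoℚ-nonNeg k = ℚP.nonNegative⁻¹ (ℕtoℚ k) {{ℚP.normalize-nonNeg k 1}}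

ℕtoℚ-mono-≤ : ∀ {a b} → a ≤ b → ℕtoℚ a ℚ.≤ ℕtoℚ b
ℕtoℚ-mono-≤ {a} {b} a≤b = begin
  ℕtoℚ a                     ≡⟨ ℚP.+-identityʳ (ℕtoℚ a) ⟨
  ℕtoℚ a ℚ.+ 0ℚ              ≤⟨ ℚP.+-monoʳ-≤ (ℕtoℚ a) (ℕtoℚ-nonNeg (b ∸ a)) ⟩
  ℕtoℚ a ℚ.+ ℕtoℚ (b ∸ a)    ≡⟨ ℕtoℚ-+ a (b ∸ a) ⟨
  ℕtoℚ (a + (b ∸ a))         ≡⟨ cong ℕtoℚ (m+[n∸m]≡n a≤b) ⟩
  ℕtoℚ b                     ∎
  where open ℚP.≤-Reasoning

ℕtoℚ-mono-< : ∀ {a b} → a < b → ℕtoℚ a ℚ.< ℕtoℚ b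
ℕtoℚ-mono-< {a} {b} a<b = begin-strict
  ℕtoℚ a                     ≡⟨ ℚP.+-identityˡ (ℕtoℚ a) ⟨
  0ℚ ℚ.+ ℕtoℚ a              <⟨ ℚP.+-monoˡ-< (ℕtoℚ a) (ℚP.positive⁻¹ 1ℚ) ⟩
  1ℚ ℚ.+ ℕtoℚ a              ≡⟨ ℕtoℚ-suc a ⟨
  ℕtoℚ (suc a)               ≤⟨ ℕtoℚ-mono-≤ a<b ⟩
  ℕtoℚ b                     ∎
  where open ℚP.≤-Reasoning

ℕtoℚ-cancel-≤ : ∀ {a b} → ℕtoℚ a ℚ.≤ ℕtoℚ b → a ≤ b
ℕtoℚ-cancel-≤ {a} {b} qa≤qb with a ≤? b
... | yes a≤b = a≤b
... | no a≰b = ⊥-elim (ℚP.<-irrefl refl (ℚP.<-≤-trans (ℕtoℚ-mono-< (≰⇒> a≰b)) qa≤qb))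

ℕtoℚ-injective : ∀ {a b} → ℕtoℚ a ≡ ℕtoℚ b → a ≡ b
ℕtoℚ-injective qa≡qb =
  ≤-antisym (ℕtoℚ-cancel-≤ (ℚP.≤-reflexive qa≡qb)) (ℕtoℚ-cancel-≤ (ℚP.≤-reflexive (sym qa≡qb)))

ℕtoℚ-∸ : ∀ {a b} → b ≤ a → ℕtoℚ (a ∸ b) ≡ ℕtoℚ a ℚ.- ℕtoℚ b
ℕtoℚ-∸ {a} {b} b≤a = begin
  ℕtoℚ (a ∸ b)                               ≡⟨ cancel (ℕtoℚ b) (ℕtoℚ (a ∸ b)) ⟩
  (ℕtoℚ b ℚ.+ ℕtoℚ (a ∸ b)) ℚ.- ℕtoℚ b       ≡⟨ cong (ℚ._- ℕtoℚ b) (ℕtoℚ-+ b (a ∸ b)) ⟨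
  ℕtoℚ (b + (a ∸ b)) ℚ.- ℕtoℚ b              ≡⟨ cong (λ c → ℕtoℚ c ℚ.- ℕtoℚ b) (m+[n∸m]≡n b≤a) ⟩
  ℕtoℚ a ℚ.- ℕtoℚ b                          ∎
  where
  open ≡-Reasoning
  cancel : ∀ p q → q ≡ (p ℚ.+ q) ℚ.- p
  cancel = solve-∀ ℚ-ring

ℕtoℚ-∣-∣ : ∀ a b → ℕtoℚ ∣ a - b ∣ ≡ ℚ.∣ ℕtoℚ a ℚ.- ℕtoℚ b ∣
ℕtoℚ-∣-∣ a b = [ ordered a b , reversed ]′ (≤-total b a)
  where
  ordered : ∀ a b → b ≤ a → ℕtoℚ ∣ a - b ∣ ≡ ℚ.∣ ℕtoℚ a ℚ.- ℕtoℚ b ∣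
  ordered a b b≤a = begin
    ℕtoℚ ∣ a - b ∣               ≡⟨ cong ℕtoℚ (m≤n⇒∣n-m∣≡n∸m b≤a) ⟩
    ℕtoℚ (a ∸ b)                 ≡⟨ ℚP.0≤p⇒∣p∣≡p (ℕtoℚ-nonNeg (a ∸ b)) ⟨
    ℚ.∣ ℕtoℚ (a ∸ b) ∣           ≡⟨ cong ℚ.∣_∣ (ℕtoℚ-∸ b≤a) ⟩
    ℚ.∣ ℕtoℚ a ℚ.- ℕtoℚ b ∣      ∎
    where open ≡-Reasoning
  negate : ∀ p q → p ℚ.- q ≡ ℚ.- (q ℚ.- p)
  negate = solve-∀ ℚ-ring
  reversed : a ≤ b → ℕtoℚ ∣ a - b ∣ ≡ ℚ.∣ ℕtoℚ a ℚ.- ℕtoℚ b ∣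
  reversed a≤b = begin
    ℕtoℚ ∣ a - b ∣                    ≡⟨ cong ℕtoℚ (∣-∣-comm a b) ⟩
    ℕtoℚ ∣ b - a ∣                    ≡⟨ ordered b a a≤b ⟩
    ℚ.∣ ℕtoℚ b ℚ.- ℕtoℚ a ∣           ≡⟨ ℚP.∣-p∣≡∣p∣ _ ⟨
    ℚ.∣ ℚ.- (ℕtoℚ b ℚ.- ℕtoℚ a) ∣     ≡⟨ cong ℚ.∣_∣ (negate (ℕtoℚ a) (ℕtoℚ b)) ⟨
    ℚ.∣ ℕtoℚ a ℚ.- ℕtoℚ b ∣           ∎
    where open ≡-Reasoning

descale-≤ : ∀ {Q E w c δ} → 0 < Q → ℕtoℚ E ≡ ℕtoℚ Q ℚ.* δ → Q * w ≤ E * c → ℕtoℚ w ℚ.≤ δ ℚ.* ℕtoℚ c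
descale-≤ {Q} {E} {w} {c} {δ} 0<Q E≡Qδ Qw≤Ec =
  ℚP.*-cancelˡ-≤-pos (ℕtoℚ Q) {{ℚ.positive (ℕtoℚ-mono-< 0<Q)}} (begin
    ℕtoℚ Q ℚ.* ℕtoℚ w          ≡⟨ ℕtoℚ-* Q w ⟨
    ℕtoℚ (Q * w)               ≤⟨ ℕtoℚ-mono-≤ Qw≤Ec ⟩
    ℕtoℚ (E * c)               ≡⟨ ℕtoℚ-* E c ⟩
    ℕtoℚ E ℚ.* ℕtoℚ c          ≡⟨ cong (ℚ._* ℕtoℚ c) E≡Qδ ⟩
    ℕtoℚ Q ℚ.* δ ℚ.* ℕtoℚ c    ≡⟨ ℚP.*-assoc (ℕtoℚ Q) δ (ℕtoℚ c) ⟩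
    ℕtoℚ Q ℚ.* (δ ℚ.* ℕtoℚ c)  ∎)
  where open ℚP.≤-Reasoning

-- Clearing denominators

record Clears (Q : ℕ) (q : ℚ) : Set where
  constructor clearing
  field
    numerator : ℕ
    numerator≡ : ℕtoℚ numerator ≡ ℕtoℚ Q ℚ.* q

sumℚ-suc : ∀ {m} (q : Fin (suc m) → ℚ) → sumℚ q ≡ q zero ℚ.+ sumℚ (q ∘ suc)
sumℚ-suc q = cong (λ qs → q zero ℚ.+ List.foldr ℚ._+_ 0ℚ qs)
  (trans (Listₚ.map-tabulate suc q) (sym (Listₚ.map-tabulate (λ i → i) (q ∘ suc))))

sum-clears : ∀ {m Q} {q : Fin m → ℚ} (c : ∀ i → Clears Q (q i)) →
  ℕtoℚ (∑[ i < m ] Clears.numerator (c i)) ≡ ℕtoℚ Q ℚ.* sumℚ q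
sum-clears {zero} {Q} c = sym (ℚP.*-zeroʳ (ℕtoℚ Q))
sum-clears {suc m} {Q} {q} c = begin
  ℕtoℚ (k zero + ∑[ i < m ] k (suc i))
    ≡⟨ ℕtoℚ-+ (k zero) _ ⟩
  ℕtoℚ (k zero) ℚ.+ ℕtoℚ (∑[ i < m ] k (suc i))
    ≡⟨ cong₂ ℚ._+_ (Clears.numerator≡ (c zero)) (sum-clears (c ∘ suc)) ⟩
  ℕtoℚ Q ℚ.* q zero ℚ.+ ℕtoℚ Q ℚ.* sumℚ (q ∘ suc)
    ≡⟨ ℚP.*-distribˡ-+ (ℕtoℚ Q) (q zero) _ ⟨
  ℕtoℚ Q ℚ.* (q zero ℚ.+ sumℚ (q ∘ suc))
    ≡⟨ cong (ℚ._*_ (ℕtoℚ Q)) (sumℚ-suc q) ⟨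
  ℕtoℚ Q ℚ.* sumℚ q
    ∎
  where
  open ≡-Reasoning
  k : Fin (suc m) → ℕ
  k i = Clears.numerator (c i)

clears-∣-∣ : ∀ {Q p q} → Clears Q p → Clears Q q → Clears Q ℚ.∣ p ℚ.- q ∣
clears-∣-∣ {Q} {p} {q} (clearing a a≡Qp) (clearing b b≡Qq) = clearing ∣ a - b ∣ (begin
  ℕtoℚ ∣ a - b ∣                         ≡⟨ ℕtoℚ-∣-∣ a b ⟩
  ℚ.∣ ℕtoℚ a ℚ.- ℕtoℚ b ∣                ≡⟨ cong₂ (λ u v → ℚ.∣ u ℚ.- v ∣) a≡Qp b≡Qq ⟩
  ℚ.∣ ℕtoℚ Q ℚ.* p ℚ.- ℕtoℚ Q ℚ.* q ∣    ≡⟨ cong ℚ.∣_∣ (factor (ℕtoℚ Q) p q) ⟩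
  ℚ.∣ ℕtoℚ Q ℚ.* (p ℚ.- q) ∣             ≡⟨ ℚP.∣p*q∣≡∣p∣*∣q∣ (ℕtoℚ Q) (p ℚ.- q) ⟩
  ℚ.∣ ℕtoℚ Q ∣ ℚ.* ℚ.∣ p ℚ.- q ∣         ≡⟨ cong (ℚ._* ℚ.∣ p ℚ.- q ∣) (ℚP.0≤p⇒∣p∣≡p (ℕtoℚ-nonNeg Q)) ⟩
  ℕtoℚ Q ℚ.* ℚ.∣ p ℚ.- q ∣               ∎)
  where
  open ≡-Reasoning
  factor : ∀ c x y → c ℚ.* x ℚ.- c ℚ.* y ≡ c ℚ.* (x ℚ.- y)
  factor = solve-∀ ℚ-ring

clears-denominator : ∀ q → 0ℚ ℚ.≤ q → Clears (ℚ.↧ₙ q) q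
clears-denominator q@(ℚ.mkℚ (ℤ.+ k) d _) _ = clearing k (ℚP.toℚᵘ-injective (begin
  ℚ.toℚᵘ (ℕtoℚ k)                          ≈⟨ ℚP.toℚᵘ-fromℚᵘ (mkℚᵘ (ℤ.+ k) 0) ⟩
  mkℚᵘ (ℤ.+ k) 0                           ≈⟨ *≡* ℤ-identity ⟨
  mkℚᵘ (ℤ.+ suc d) 0 ℚᵘ.* ℚ.toℚᵘ q         ≈⟨ ℚᵘP.*-congʳ (ℚP.toℚᵘ-fromℚᵘ (mkℚᵘ (ℤ.+ suc d) 0)) ⟨
  ℚ.toℚᵘ (ℕtoℚ (suc d)) ℚᵘ.* ℚ.toℚᵘ q      ≈⟨ ℚP.toℚᵘ-homo-* (ℕtoℚ (suc d)) q ⟨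
  ℚ.toℚᵘ (ℕtoℚ (suc d) ℚ.* q)              ∎))
  where
  open ℚᵘP.≃-Reasoning
  ℤ-identity : ℤ.+ suc d ℤ.* ℤ.+ k ℤ.* ℤ.1ℤ ≡ ℤ.+ k ℤ.* ℤ.+ (1 * suc d)
  ℤ-identity = trans (ℤP.*-identityʳ _)
    (trans (ℤP.*-comm (ℤ.+ suc d) (ℤ.+ k)) (cong (λ e → ℤ.+ k ℤ.* ℤ.+ e) (sym (*-identityˡ (suc d)))))
clears-denominator (ℚ.mkℚ ℤ.-[1+ k ] d _) (ℚ.*≤* ())

∃-clearing : ∀ q → 0ℚ ℚ.≤ q → ∃[ Q ] 0 < Q × Clears Q q
∃-clearing q@(ℚ.mkℚ _ d _) 0≤q = suc d , s≤s z≤n , clears-denominator q 0≤q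

clears-multiple : ∀ {Q q} c → Clears Q q → Clears (Q * c) q
clears-multiple {Q} {q} c (clearing k k≡Qq) = clearing (k * c) (begin
  ℕtoℚ (k * c)                       ≡⟨ ℕtoℚ-* k c ⟩
  ℕtoℚ k ℚ.* ℕtoℚ c                  ≡⟨ cong (ℚ._* ℕtoℚ c) k≡Qq ⟩
  ℕtoℚ Q ℚ.* q ℚ.* ℕtoℚ c            ≡⟨ rearrange (ℕtoℚ Q) q (ℕtoℚ c) ⟩
  ℕtoℚ Q ℚ.* ℕtoℚ c ℚ.* q            ≡⟨ cong (ℚ._* q) (ℕtoℚ-* Q c) ⟨
  ℕtoℚ (Q * c) ℚ.* q                 ∎)
  where
  open ≡-Reasoning
  rearrange : ∀ a b x → a ℚ.* b ℚ.* x ≡ a ℚ.* x ℚ.* b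
  rearrange = solve-∀ ℚ-ring

common-multiple : ∀ {m} (P : Fin m → ℕ → Set) → (∀ {i Q} c → P i Q → P i (Q * c)) →
  (∀ i → ∃[ Q ] 0 < Q × P i Q) → ∃[ Q ] 0 < Q × (∀ i → P i Q)
common-multiple {zero} P multiple each = 1 , s≤s z≤n , λ ()
common-multiple {suc m} P multiple each with each zero | common-multiple (P ∘ suc) multiple (each ∘ suc)
... | Q₀ , 0<Q₀ , P₀ | Q₊ , 0<Q₊ , P₊ = Q₀ * Q₊ , *-mono-< 0<Q₀ 0<Q₊ , λ where
  zero → multiple Q₊ P₀
  (suc i) → subst (P (suc i)) (*-comm Q₊ Q₀) (multiple Q₀ (P₊ i))

common-denominator : ∀ {m k} (f : Fin m → Fin k → ℚ) (ε : ℚ) → (∀ x z → 0ℚ ℚ.≤ f x z) → 0ℚ ℚ.≤ ε →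
  ∃[ Q ] 0 < Q × (∀ x z → Clears Q (f x z)) × Clears Q ε
common-denominator {m} {k} f ε 0≤f 0≤ε = combine (common-multiple Row row-multiple row) (∃-clearing ε 0≤ε)
  where
  Row : Fin m → ℕ → Set
  Row x Q = ∀ z → Clears Q (f x z)
  row-multiple : ∀ {x Q} c → Row x Q → Row x (Q * c)
  row-multiple c clears z = clears-multiple c (clears z)
  row : ∀ x → ∃[ Q ] 0 < Q × Row x Q
  row x = common-multiple (λ z Q → Clears Q (f x z)) clears-multiple (λ z → ∃-clearing (f x z) (0≤f x z))
  combine : ∃[ Q ] 0 < Q × (∀ x → Row x Q) → ∃[ Q ] 0 < Q × Clears Q ε →
    ∃[ Q ] 0 < Q × (∀ x z → Clears Q (f x z)) × Clears Q ε
  combine (Q , 0<Q , f-clears) (Qε , 0<Qε , ε-clears) =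
    Q * Qε , *-mono-< 0<Q 0<Qε , (λ x z → clears-multiple Qε (f-clears x z)) ,
    subst (λ Q′ → Clears Q′ ε) (*-comm Qε Q) (clears-multiple Q ε-clears)

-- Greedy clustering

module _ {A : Set} (_≟_ : DecidableEquality A) where

  private
    _≟ₘ_ : DecidableEquality (Maybe A)
    _≟ₘ_ = Maybeₚ.≡-dec _≟_

  relabel : A → Bool → Maybe A → Maybe A
  relabel z b l = if is-nothing l ∧ b then just z else l

  relabel-free : ∀ z b l e →
    ⟦ is-nothing l ∧ e ⟧ ≡ ⟦ is-nothing l ∧ e ⟧ * ⟦ b ⟧ + ⟦ is-nothing (relabel z b l) ∧ e ⟧
  relabel-free z b (just _) e = refl
  relabel-free z true nothing true = refl
  relabel-free z true nothing false = refl
  relabel-free z false nothing true = refl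
  relabel-free z false nothing false = refl

  -- A pair separated only after relabelling has one end newly captured and the other left unlabelled.
  relabel-separates : ∀ z bx by e lx ly →
    ⟦ e ∧ not (does (relabel z bx lx ≟ₘ relabel z by ly)) ⟧ ≤
      ⟦ e ∧ not (does (lx ≟ₘ ly)) ⟧
      + ⟦ is-nothing lx ∧ e ⟧ * ⟦ is-nothing ly ∧ (bx ∧ not by) ⟧
      + ⟦ is-nothing ly ∧ e ⟧ * ⟦ is-nothing lx ∧ (by ∧ not bx) ⟧
  relabel-separates z bx by false lx ly = z≤n
  relabel-separates z bx by true (just u) (just v) = ≤-trans (m≤m+n _ _) (m≤m+n _ _)
  relabel-separates z bx by true nothing (just v) = ⟦⟧≤1 _
  relabel-separates z bx by true (just u) nothing = ⟦⟧≤1 _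
  relabel-separates z true true true nothing nothing
    rewrite dec-true (just z ≟ₘ just z) refl = z≤n
  relabel-separates z true false true nothing nothing = ≤-refl
  relabel-separates z false true true nothing nothing = ≤-refl
  relabel-separates z false false true nothing nothing = z≤n

-- A vertex is labelled by the centre of its cluster, or by nothing while it is still unassigned.
Labelling : ℕ → Set
Labelling m = Fin m → Maybe (Fin m)

_≟ℓ_ : ∀ {m} → DecidableEquality (Maybe (Fin m))
_≟ℓ_ = Maybeₚ.≡-dec Fin._≟_

cut : (G : Graph) → Labelling (n G) → Fin (n G) → Fin (n G) → Bool
cut G ℓ x y = adj G x y ∧ not (does (ℓ x ≟ℓ ℓ y))

cut-sym : ∀ G ℓ x y → cut G ℓ x y ≡ cut G ℓ y x
cut-sym G ℓ x y = cong₂ (λ e s → e ∧ not s) (adj-sym G x y) (does-≡ (ℓ x ≟ℓ ℓ y) (map′ sym sym (ℓ y ≟ℓ ℓ x)))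

cut-irrefl : ∀ G ℓ x → cut G ℓ x x ≡ false
cut-irrefl G ℓ x = cong (λ e → e ∧ not (does (ℓ x ≟ℓ ℓ x))) (adj-irrefl G x)

module GreedyClustering (G : Graph) (Q : ℕ) (0<Q : 0 < Q) (a : Fin (n G) → Fin (n G) → ℕ)
  (∑a≡Q : ∀ x → sum (a x) ≡ Q) (M : ℕ)
  (a-close : ∀ x y → adj G x y ≡ true → ∑[ z < n G ] ∣ a x z - a y z ∣ ≤ M) where

  V : Set
  V = Fin (n G)

  free : Labelling (n G) → V → Bool
  free ℓ x = is-nothing (ℓ x)

  free-arc : Labelling (n G) → V → V → ℕ
  free-arc ℓ x y = ⟦ free ℓ x ∧ adj G x y ⟧

  volume : Labelling (n G) → ℕ
  volume ℓ = ∑[ x < n G ] ∑[ y < n G ] free-arc ℓ x y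

  above : V → Fin Q → V → Bool
  above z t x = toℕ t <ᵇ a x z

  captured : Labelling (n G) → V → Fin Q → ℕ
  captured ℓ z t = ∑[ x < n G ] ∑[ y < n G ] (free-arc ℓ x y * ⟦ above z t x ⟧)

  leaves : Labelling (n G) → V → Fin Q → V → V → Bool
  leaves ℓ z t x y = free ℓ y ∧ (above z t x ∧ not (above z t y))

  crossing : Labelling (n G) → V → Fin Q → ℕ
  crossing ℓ z t = ∑[ x < n G ] ∑[ y < n G ] (free-arc ℓ x y * ⟦ leaves ℓ z t x y ⟧)

  assign : Labelling (n G) → V → Fin Q → Labelling (n G)
  assign ℓ z t x = relabel Fin._≟_ z (above z t x) (ℓ x)

  ∑-levels : ∀ ℓ (h : V → Fin Q → V → V → ℕ) →
    ∑[ z < n G ] ∑[ t < Q ] ∑[ x < n G ] ∑[ y < n G ] (free-arc ℓ x y * h z t x y)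
    ≡ ∑[ x < n G ] ∑[ y < n G ] (free-arc ℓ x y * ∑[ z < n G ] ∑[ t < Q ] h z t x y)
  ∑-levels ℓ h = trans (∑∑-∑-comm (λ z t x → ∑[ y < n G ] (free-arc ℓ x y * h z t x y)))
    (sum-cong-≗ λ x → trans (∑∑-∑-comm (λ z t y → free-arc ℓ x y * h z t x y))
      (sum-cong-≗ λ y → ∑∑-distribˡ (free-arc ℓ x y) (λ z t → h z t x y)))

  volume-* : ∀ ℓ c → ∑[ x < n G ] ∑[ y < n G ] (free-arc ℓ x y * c) ≡ c * volume ℓ
  volume-* ℓ c =
    trans (sum-cong-≗ λ x → sum-cong-≗ λ y → *-comm (free-arc ℓ x y) c) (∑∑-distribˡ c (free-arc ℓ))

  ∑-captured : ∀ ℓ → ∑[ z < n G ] ∑[ t < Q ] captured ℓ z t ≡ Q * volume ℓ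
  ∑-captured ℓ = begin
    ∑[ z < n G ] ∑[ t < Q ] captured ℓ z t
      ≡⟨ ∑-levels ℓ (λ z t x y → ⟦ above z t x ⟧) ⟩
    ∑[ x < n G ] ∑[ y < n G ] (free-arc ℓ x y * ∑[ z < n G ] ∑[ t < Q ] ⟦ above z t x ⟧)
      ≡⟨ sum-cong-≗ (λ x → sum-cong-≗ λ y → cong (free-arc ℓ x y *_) (levels x)) ⟩
    ∑[ x < n G ] ∑[ y < n G ] (free-arc ℓ x y * Q)
      ≡⟨ volume-* ℓ Q ⟩
    Q * volume ℓ
      ∎
    where
    open ≡-Reasoning
    levels : ∀ x → ∑[ z < n G ] ∑[ t < Q ] ⟦ above z t x ⟧ ≡ Q
    levels x = trans (sum-cong-≗ λ z → trans (count-below Q (a x z))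
      (m≤n⇒m⊓n≡m (subst (a x z ≤_) (∑a≡Q x) (term≤sum (a x) z)))) (∑a≡Q x)

  ∑-crossing : ∀ ℓ → ∑[ z < n G ] ∑[ t < Q ] crossing ℓ z t ≤ M * volume ℓ
  ∑-crossing ℓ = begin
    ∑[ z < n G ] ∑[ t < Q ] crossing ℓ z t
      ≡⟨ ∑-levels ℓ (λ z t x y → ⟦ leaves ℓ z t x y ⟧) ⟩
    ∑[ x < n G ] ∑[ y < n G ] (free-arc ℓ x y * ∑[ z < n G ] ∑[ t < Q ] ⟦ leaves ℓ z t x y ⟧)
      ≤⟨ sum-mono-≤ (λ x → sum-mono-≤ λ y → bound x y) ⟩
    ∑[ x < n G ] ∑[ y < n G ] (free-arc ℓ x y * M)
      ≡⟨ volume-* ℓ M ⟩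
    M * volume ℓ
      ∎
    where
    open ≤-Reasoning
    separated : ∀ x y → adj G x y ≡ true → ∑[ z < n G ] ∑[ t < Q ] ⟦ leaves ℓ z t x y ⟧ ≤ M
    separated x y xy = ≤-trans (sum-mono-≤ {n G} λ z → ≤-trans (sum-mono-≤ {Q} λ t → ⟦∧⟧≤⟦⟧ʳ (free ℓ y) _)
      (≤-trans (count-between Q (a x z) (a y z)) (m∸n≤∣m-n∣ (a x z) (a y z)))) (a-close x y xy)
    bound : ∀ x y → free-arc ℓ x y * ∑[ z < n G ] ∑[ t < Q ] ⟦ leaves ℓ z t x y ⟧ ≤ free-arc ℓ x y * M
    bound x y with free ℓ x | adj G x y in xy
    ... | true | true = +-monoˡ-≤ 0 (separated x y xy)
    ... | true | false = z≤n
    ... | false | _ = z≤n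

  good-level : ∀ ℓ → 0 < volume ℓ → ∃[ z ] ∃[ t ] 0 < captured ℓ z t × crossing ℓ z t * Q ≤ M * captured ℓ z t
  good-level ℓ 0<vol with ∃-below-average (λ z → ∑[ t < Q ] crossing ℓ z t) (λ z → ∑[ t < Q ] captured ℓ z t)
                            {Q} {M} 0<∑∑ ∑∑-below
    where
    0<∑∑ : 0 < ∑[ z < n G ] ∑[ t < Q ] captured ℓ z t
    0<∑∑ = subst (0 <_) (sym (∑-captured ℓ)) (*-mono-< 0<Q 0<vol)
    ∑∑-below : (∑[ z < n G ] ∑[ t < Q ] crossing ℓ z t) * Q ≤ M * ∑[ z < n G ] ∑[ t < Q ] captured ℓ z t
    ∑∑-below = begin
      (∑[ z < n G ] ∑[ t < Q ] crossing ℓ z t) * Q  ≤⟨ *-monoˡ-≤ Q (∑-crossing ℓ) ⟩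
      M * volume ℓ * Q                              ≡⟨ *-assoc M (volume ℓ) Q ⟩
      M * (volume ℓ * Q)                            ≡⟨ cong (M *_) (*-comm (volume ℓ) Q) ⟩
      M * (Q * volume ℓ)                            ≡⟨ cong (M *_) (∑-captured ℓ) ⟨
      M * ∑[ z < n G ] ∑[ t < Q ] captured ℓ z t    ∎
      where open ≤-Reasoning
  ... | z , 0<∑captured , below = z , ∃-below-average (crossing ℓ z) (captured ℓ z) {Q} {M} 0<∑captured below

  Centred : Labelling (n G) → Set
  Centred ℓ = ∀ x z → ℓ x ≡ just z → 0 < a x z

  Potential : Labelling (n G) → Set
  Potential ℓ = Q * arcs (cut G ℓ) + 2 * M * volume ℓ ≤ 2 * M * arcs (adj G)

  CentredClustering : Set
  CentredClustering = ∃[ ℓ ] (∀ x → ℓ x ≡ nothing → ∀ y → adj G x y ≡ false)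
    × Centred ℓ × Q * arcs (cut G ℓ) ≤ 2 * M * arcs (adj G)

  assign-centred : ∀ ℓ z t → Centred ℓ → Centred (assign ℓ z t)
  assign-centred ℓ z t centred x w with ℓ x in ℓx | above z t x in above-x
  ... | just u | _ = centred x w ∘ trans ℓx
  ... | nothing | true = λ { refl → ≤-<-trans z≤n (<ᵇ⇒< (toℕ t) (a x z) (subst T (sym above-x) _)) }
  ... | nothing | false = λ ()

  assign-volume : ∀ ℓ z t → volume ℓ ≡ captured ℓ z t + volume (assign ℓ z t)
  assign-volume ℓ z t = trans
    (sum-cong-≗ λ x → sum-cong-≗ λ y → relabel-free Fin._≟_ z (above z t x) (ℓ x) (adj G x y))
    (∑∑-distrib-+ (λ x y → free-arc ℓ x y * ⟦ above z t x ⟧) (free-arc (assign ℓ z t)))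

  assign-cut : ∀ ℓ z t → arcs (cut G (assign ℓ z t)) ≤ arcs (cut G ℓ) + 2 * crossing ℓ z t
  assign-cut ℓ z t = begin
    arcs (cut G (assign ℓ z t))
      ≤⟨ sum-mono-≤ (λ x → sum-mono-≤ λ y →
           relabel-separates Fin._≟_ z (above z t x) (above z t y) (adj G x y) (ℓ x) (ℓ y)) ⟩
    ∑[ x < n G ] ∑[ y < n G ] (⟦ cut G ℓ x y ⟧ + cross x y + cross′ x y)
      ≡⟨ trans (∑∑-distrib-+ (λ x y → ⟦ cut G ℓ x y ⟧ + cross x y) cross′)
           (cong (_+ ∑[ x < n G ] ∑[ y < n G ] cross′ x y) (∑∑-distrib-+ (λ x y → ⟦ cut G ℓ x y ⟧) cross)) ⟩
    arcs (cut G ℓ) + crossing ℓ z t + ∑[ x < n G ] ∑[ y < n G ] cross′ x y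
      ≡⟨ cong (arcs (cut G ℓ) + crossing ℓ z t +_) (trans (∑-comm cross′) (sum-cong-≗ λ y → sum-cong-≗ λ x →
           cong (λ e → ⟦ free ℓ y ∧ e ⟧ * ⟦ leaves ℓ z t y x ⟧) (adj-sym G x y))) ⟩
    arcs (cut G ℓ) + crossing ℓ z t + crossing ℓ z t
      ≡⟨ trans (+-assoc (arcs (cut G ℓ)) _ _)
           (cong (λ c → arcs (cut G ℓ) + (crossing ℓ z t + c)) (sym (+-identityʳ (crossing ℓ z t)))) ⟩
    arcs (cut G ℓ) + 2 * crossing ℓ z t
      ∎
    where
    open ≤-Reasoning
    cross cross′ : V → V → ℕ
    cross x y = free-arc ℓ x y * ⟦ leaves ℓ z t x y ⟧
    cross′ x y = ⟦ free ℓ y ∧ adj G x y ⟧ * ⟦ leaves ℓ z t y x ⟧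

  assign-potential : ∀ ℓ z t → crossing ℓ z t * Q ≤ M * captured ℓ z t → Potential ℓ → Potential (assign ℓ z t)
  assign-potential ℓ z t below potential = begin
    Q * arcs (cut G ℓ′) + 2 * M * volume ℓ′
      ≤⟨ +-monoˡ-≤ (2 * M * volume ℓ′) (*-monoʳ-≤ Q (assign-cut ℓ z t)) ⟩
    Q * (arcs (cut G ℓ) + 2 * crossing ℓ z t) + 2 * M * volume ℓ′
      ≡⟨ regroup Q (arcs (cut G ℓ)) (crossing ℓ z t) (2 * M * volume ℓ′) ⟩
    Q * arcs (cut G ℓ) + 2 * (crossing ℓ z t * Q) + 2 * M * volume ℓ′
      ≤⟨ +-monoˡ-≤ (2 * M * volume ℓ′) (+-monoʳ-≤ (Q * arcs (cut G ℓ)) (*-monoʳ-≤ 2 below)) ⟩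
    Q * arcs (cut G ℓ) + 2 * (M * captured ℓ z t) + 2 * M * volume ℓ′
      ≡⟨ factor (Q * arcs (cut G ℓ)) M (captured ℓ z t) (volume ℓ′) ⟩
    Q * arcs (cut G ℓ) + 2 * M * (captured ℓ z t + volume ℓ′)
      ≡⟨ cong (λ v → Q * arcs (cut G ℓ) + 2 * M * v) (assign-volume ℓ z t) ⟨
    Q * arcs (cut G ℓ) + 2 * M * volume ℓ
      ≤⟨ potential ⟩
    2 * M * arcs (adj G)
      ∎
    where
    open ≤-Reasoning
    ℓ′ : Labelling (n G)
    ℓ′ = assign ℓ z t
    regroup : ∀ q c x w → q * (c + 2 * x) + w ≡ q * c + 2 * (x * q) + w
    regroup = ℕ-Solver.solve-∀
    factor : ∀ p m c v → p + 2 * (m * c) + 2 * m * v ≡ p + 2 * m * (c + v)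
    factor = ℕ-Solver.solve-∀

  greedy-step : ∀ ℓ → Centred ℓ → Potential ℓ → 0 < volume ℓ →
    ∃[ ℓ′ ] Centred ℓ′ × Potential ℓ′ × volume ℓ′ < volume ℓ
  greedy-step ℓ centred potential 0<vol with good-level ℓ 0<vol
  ... | z , t , 0<captured , below =
    assign ℓ z t , assign-centred ℓ z t centred , assign-potential ℓ z t below potential ,
    subst (volume (assign ℓ z t) <_) (sym (assign-volume ℓ z t)) (+-monoˡ-< _ 0<captured)

  volume≡0⇒isolated : ∀ ℓ → volume ℓ ≡ 0 → ∀ x → ℓ x ≡ nothing → ∀ y → adj G x y ≡ false
  volume≡0⇒isolated ℓ vol≡0 x ℓx≡nothing y with adj G x y in xy
  ... | false = refl
  ... | true = ⊥-elim (1+n≰n (begin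
    1                                 ≡⟨ cong (λ l → ⟦ is-nothing l ∧ true ⟧) ℓx≡nothing ⟨
    ⟦ free ℓ x ∧ true ⟧               ≡⟨ cong (λ e → ⟦ free ℓ x ∧ e ⟧) xy ⟨
    free-arc ℓ x y                    ≤⟨ term≤sum (free-arc ℓ x) y ⟩
    ∑[ y < n G ] free-arc ℓ x y       ≤⟨ term≤sum (λ x → ∑[ y < n G ] free-arc ℓ x y) x ⟩
    volume ℓ                          ≡⟨ vol≡0 ⟩
    0                                 ∎))
    where open ≤-Reasoning

  terminal : ∀ ℓ → volume ℓ ≡ 0 → Centred ℓ → Potential ℓ → CentredClustering
  terminal ℓ vol≡0 centred potential =
    ℓ , volume≡0⇒isolated ℓ vol≡0 , centred , ≤-trans (m≤m+n _ _) potential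

  greedy : ∀ k ℓ → volume ℓ ≤ k → Centred ℓ → Potential ℓ → CentredClustering
  greedy zero ℓ vol≤0 centred potential = terminal ℓ (n≤0⇒n≡0 vol≤0) centred potential
  greedy (suc k) ℓ vol≤k centred potential = continue (volume ℓ ≟ 0)
    where
    continue : Dec (volume ℓ ≡ 0) → CentredClustering
    continue (yes vol≡0) = terminal ℓ vol≡0 centred potential
    continue (no vol≢0) =
      let ℓ′ , centred′ , potential′ , vol′<vol = greedy-step ℓ centred potential (n≢0⇒n>0 vol≢0)
      in greedy k ℓ′ (≤-pred (≤-trans vol′<vol vol≤k)) centred′ potential′

  centred-clustering : CentredClustering
  centred-clustering = greedy (volume unlabelled) unlabelled ≤-refl (λ _ _ ()) initial
    where
    unlabelled : Labelling (n G)
    unlabelled _ = nothing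
    nothing-cut : arcs (cut G unlabelled) ≡ 0
    nothing-cut = trans (sum-cong-≗ λ x → trans (sum-cong-≗ λ y → cong ⟦_⟧ (Boolₚ.∧-zeroʳ (adj G x y)))
      (sum-replicate-zero (n G))) (sum-replicate-zero (n G))
    initial : Potential unlabelled
    initial = ≤-reflexive (cong (_+ 2 * M * arcs (adj G)) (trans (cong (Q *_) nothing-cut) (*-zeroʳ Q)))

-- From uniformity to hyperfiniteness

record Clustering (G : Graph) (r : ℕ) (δ : ℚ) : Set where
  field
    label : Labelling (n G)
    unlabelled-isolated : ∀ x → label x ≡ nothing → ∀ y → adj G x y ≡ false
    near-centre : ∀ x z → label x ≡ just z → InBall G r x z
    few-cut-edges : ℕtoℚ (countEdges (cut G label)) ℚ.≤ δ ℚ.* ℕtoℚ (countEdges (adj G))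

uniform⇒clustering : ∀ {ε r G} → 0ℚ ℚ.< ε → Uniform ε r G → Clustering G r (ℕtoℚ 2 ℚ.* ε)
uniform⇒clustering {ε} {r} {G} 0<ε (f , prob , close , supp) =
  from-denominator (common-denominator f ε (λ x → proj₁ (prob x)) (ℚP.<⇒≤ 0<ε))
  where
  from-denominator : ∃[ Q ] 0 < Q × (∀ x z → Clears Q (f x z)) × Clears Q ε → Clustering G r (ℕtoℚ 2 ℚ.* ε)
  from-denominator (Q , 0<Q , f-clears , clearing E E≡Qε) =
    from-greedy (GreedyClustering.centred-clustering G Q 0<Q a ∑a≡Q E a-close)
    where
    instance
      Q-positive : ℚ.Positive (ℕtoℚ Q)
      Q-positive = ℚ.positive (ℕtoℚ-mono-< 0<Q)
    a : Fin (n G) → Fin (n G) → ℕ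
    a x z = Clears.numerator (f-clears x z)
    ∑a≡Q : ∀ x → sum (a x) ≡ Q
    ∑a≡Q x = ℕtoℚ-injective (begin
      ℕtoℚ (sum (a x))          ≡⟨ sum-clears (f-clears x) ⟩
      ℕtoℚ Q ℚ.* sumℚ (f x)     ≡⟨ cong (ℚ._*_ (ℕtoℚ Q)) (proj₂ (prob x)) ⟩
      ℕtoℚ Q ℚ.* 1ℚ             ≡⟨ ℚP.*-identityʳ (ℕtoℚ Q) ⟩
      ℕtoℚ Q                    ∎)
      where open ≡-Reasoning
    a-close : ∀ x y → adj G x y ≡ true → ∑[ z < n G ] ∣ a x z - a y z ∣ ≤ E
    a-close x y xy = ℕtoℚ-cancel-≤ (ℚP.<⇒≤ (begin-strict
      ℕtoℚ (∑[ z < n G ] ∣ a x z - a y z ∣)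
        ≡⟨ sum-clears (λ z → clears-∣-∣ (f-clears x z) (f-clears y z)) ⟩
      ℕtoℚ Q ℚ.* dist1 (f x) (f y)   <⟨ ℚP.*-monoʳ-<-pos (ℕtoℚ Q) (close x y xy) ⟩
      ℕtoℚ Q ℚ.* ε                   ≡⟨ E≡Qε ⟨
      ℕtoℚ E                         ∎))
      where open ℚP.≤-Reasoning
    f≢0 : ∀ {x z} → 0 < a x z → f x z ≢ 0ℚ
    f≢0 {x} {z} 0<a fxz≡0 = <⇒≢ 0<a (sym (ℕtoℚ-injective (begin
      ℕtoℚ (a x z)       ≡⟨ Clears.numerator≡ (f-clears x z) ⟩
      ℕtoℚ Q ℚ.* f x z   ≡⟨ cong (ℚ._*_ (ℕtoℚ Q)) fxz≡0 ⟩
      ℕtoℚ Q ℚ.* 0ℚ      ≡⟨ ℚP.*-zeroʳ (ℕtoℚ Q) ⟩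
      0ℚ                 ∎)))
      where open ≡-Reasoning
    2E≡Q2ε : ℕtoℚ (2 * E) ≡ ℕtoℚ Q ℚ.* (ℕtoℚ 2 ℚ.* ε)
    2E≡Q2ε = trans (ℕtoℚ-* 2 E) (trans (cong (ℚ._*_ (ℕtoℚ 2)) E≡Qε) (swap (ℕtoℚ 2) (ℕtoℚ Q) ε))
      where
      swap : ∀ t q e → t ℚ.* (q ℚ.* e) ≡ q ℚ.* (t ℚ.* e)
      swap = solve-∀ ℚ-ring
    from-greedy : GreedyClustering.CentredClustering G Q 0<Q a ∑a≡Q E a-close → Clustering G r (ℕtoℚ 2 ℚ.* ε)
    from-greedy (ℓ , isolated , centred , cut-bound) = record
      { label = ℓ
      ; unlabelled-isolated = isolated
      ; near-centre = λ x z ℓx≡z → supp x z (f≢0 (centred x z ℓx≡z))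
      ; few-cut-edges = descale-≤ {Q} {2 * E} {countEdges (cut G ℓ)} 0<Q 2E≡Q2ε
          (halve-arcs {p = Q} {2 * E} (cut-sym G ℓ) (cut-irrefl G ℓ) (adj-sym G) (adj-irrefl G) cut-bound)
      }

SizeLe-⊆ : ∀ {m} {P B : Fin m → Set} → (∀ y → Dec (P y)) → (∀ y → P y → B y) → ∀ {K} → SizeLe B K → SizeLe P K
SizeLe-⊆ P? P⊆B (k , (L , unique , length≡k , ∈L⇔B) , k≤K) =
  length (filter P? L) ,
  (filter P? L , Uniqueₚ.filter⁺ P? unique , refl ,
    λ y → mk⇔ (proj₂ ∘ ∈ₚ.∈-filter⁻ P? {xs = L})
              (λ Py → ∈ₚ.∈-filter⁺ P? (Equivalence.from (∈L⇔B y) (P⊆B y Py)) Py)) ,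
  ≤-trans (Listₚ.length-filter P? L) (≤-trans (≤-reflexive length≡k) k≤K)

clustering⇒hyperfinite : ∀ {G r s N δ} → r ≤ s → (∀ x → SizeLe (InBall G s x) N) → Clustering G r δ →
  Hyperfinite δ N G
clustering⇒hyperfinite {G} {r} {s} {N} {δ} r≤s ball-bound C =
  cut G label , cut-sym G label , (λ x y → Boolₚ.∧-conicalˡ (adj G x y) _) , few-cut-edges ,
  λ x → let c , component⊆ball = component-in-ball x in
    SizeLe-⊆ (reachable? uncut x) component⊆ball (ball-bound c)
  where
  open Clustering C
  uncut : Fin (n G) → Fin (n G) → Bool
  uncut a b = adj G a b ∧ not (cut G label a b)
  same-label : ∀ a b → adj G a b ∧ not (adj G a b ∧ not (does (label a ≟ℓ label b))) ≡ true → label a ≡ label b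
  same-label a b uncut-ab with label a ≟ℓ label b | adj G a b
  ... | yes ℓa≡ℓb | _ = ℓa≡ℓb
  same-label a b () | no _ | true
  same-label a b () | no _ | false
  component-in-ball : ∀ x → ∃[ c ] (∀ y → Reachable uncut x y → InBall G s c y)
  component-in-ball x with label x in ℓx
  ... | nothing = x , λ y (_ , w) → subst (InBall G s x)
    (sym (walk-from-isolated (λ v → cong (λ e → e ∧ not (cut G label x v)) (unlabelled-isolated x ℓx v)) w))
    (0 , z≤n , here)
  ... | just z = z , λ y (_ , w) →
    let k , k≤r , y⇝z = near-centre y z (trans (sym (walk-invariant label same-label w)) ℓx)
    in k , ≤-trans k≤r r≤s , walk-reverse (adj-sym G) y⇝z

hyperfinite-mono : ∀ {δ δ′ K G} → δ ℚ.≤ δ′ → Hyperfinite δ K G → Hyperfinite δ′ K G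
hyperfinite-mono {G = G} δ≤δ′ (W , W-sym , W⊆adj , few-edges , components) =
  W , W-sym , W⊆adj ,
  ℚP.≤-trans few-edges (ℚP.*-monoʳ-≤-nonNeg (ℕtoℚ edge-count) {{ℚ.nonNegative (ℕtoℚ-nonNeg edge-count)}} δ≤δ′) ,
  components
  where
  edge-count : ℕ
  edge-count = countEdges (adj G)

2ε≤d²ε/2 : ∀ {d ε} → 2 ≤ d → 0ℚ ℚ.≤ ε → ℕtoℚ 2 ℚ.* ε ℚ.≤ ℕtoℚ (d * d) ℚ.* ε ℚ.* ℚ.½
2ε≤d²ε/2 {d} {ε} 2≤d 0≤ε = begin
  ℕtoℚ 2 ℚ.* ε                 ≡⟨ cong (ℚ._* ε) 2≡4*½ ⟩
  ℕtoℚ 4 ℚ.* ℚ.½ ℚ.* ε         ≡⟨ swap (ℕtoℚ 4) ℚ.½ ε ⟩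
  ℕtoℚ 4 ℚ.* ε ℚ.* ℚ.½
    ≤⟨ ℚP.*-monoʳ-≤-nonNeg ℚ.½ (ℚP.*-monoʳ-≤-nonNeg ε {{ℚ.nonNegative 0≤ε}} (ℕtoℚ-mono-≤ (*-mono-≤ 2≤d 2≤d))) ⟩
  ℕtoℚ (d * d) ℚ.* ε ℚ.* ℚ.½   ∎
  where
  open ℚP.≤-Reasoning
  2≡4*½ : ℕtoℚ 2 ≡ ℕtoℚ 4 ℚ.* ℚ.½
  2≡4*½ = refl
  swap : ∀ a b c → a ℚ.* b ℚ.* c ≡ a ℚ.* c ℚ.* b
  swap = solve-∀ ℚ-ring

open import Data.Integer using (+_)

proposition7p1 : (d : ℕ) → 1 < d → (ε : ℚ) → 0ℚ ℚ.< ε → (r : ℕ) → 1 ≤ r →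
    (N : ℕ) → IsMaxBallSize d (2 * r) N →
    (G : Graph) → InA d ε r G →
    InH d ((ℕtoℚ (d * d) ℚ.* ε) ℚ.* (+ 1 ℚ./ 2)) N G
proposition7p1 d 1<d ε 0<ε r _ N (ball-bound , _) G (max-degree , uniform) =
  max-degree ,
  hyperfinite-mono {K = N} {G} (2ε≤d²ε/2 1<d (ℚP.<⇒≤ 0<ε))
    (clustering⇒hyperfinite {G} {N = N} (m≤n*m r 2) (ball-bound G max-degree) (uniform⇒clustering 0<ε uniform))
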